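{- Let $I=C_k$ with $k$ odd, $k\ge 3$, let $(\mathfrak M_i)_{i\in I}$ be connected partial linear spaces and $\phi_i=(\phi'_i,\phi''_i)$ correlations of $\mathfrak M_i$ onto $\mathfrak M_{i+1}$, and let $\mathfrak M_0=\langle S_0,L_0,\mathrm I_0\rangle$ be the member of index $0$. If $\varkappa=\phi_{k-1}\circ\dots\circ\phi_1\circ\phi_0$ is an involutive correlation of $\mathfrak M_0$, then $\circledast_{i\in I}(\mathfrak M_i,\phi_i)\cong \mathfrak M_0\circledast_{\varkappa} k$.
   Context: PLS: incidence structure $\langle S,\mathcal L,\mathrm I\rangle$, $S\cap\mathcal L=\emptyset$, every line on at least two points, every point on at least two lines, two distinct points on at most one common line; connected means connected collinearity graph. A correlation of $\langle S_1,\mathcal L_1,\mathrm I_1\rangle$ onto $\langle S_2,\mathcal L_2,\mathrm I_2\rangle$ is a pair $(\phi',\phi'')$ of bijections $S_1\to\mathcal L_2$, $\mathcal L_1\to S_2$ with $a\,\mathrm I_1\,l\iff\phi''(l)\,\mathrm I_2\,\phi'(a)$; composition is componentwise ($(\psi\phi)'=\psi''\phi'$, $(\psi\phi)''=\psi'\phi''$); a correlation $\varkappa$ of a structure onto itself is involutive if $\varkappa\varkappa=\mathrm{id}$. Glued structure $\circledast_{i\in I}(\mathfrak M_i,\phi_i)$: points $\bigcup_i\{i\}\times M_i$, lines $\bigcup_i\{i\}\times\mathcal L_i$ (written $[i,m]$), $(i,a)\,\mathrm I\,[j,m]$ iff either $i=j$ and $a\,\mathrm I_i\,m$, or $i=j+1$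 and $a=\phi''_j(m)$. Correlative multiplying: for a PLS $\mathfrak M_0$ with correlation $\varkappa_0$ and an integer $k>2$, $\mathfrak M_0\circledast_{\varkappa_0}k$ has point set $C_k\times S_0$ (points $(i,a)$), line set $C_k\times L_0$ (lines $[i,l]$), and $(i,a)\,\mathrm I\,[j,l]$ iff either $i=j$ and $a\,\mathrm I_0\,l$, or $i=j+1$ and $a=\varkappa_0(l)$ (the image of $l$ under the line part of $\varkappa_0$). -}

module Defs where

open import Data.Nat using (ℕ; zero; suc; _+_; _*_; _%_; NonZero)
open import Data.Nat.DivMod using (_mod_; %-distribˡ-+; m%n%n≡m%n; n%n≡0)
open import Data.Fin using (Fin; toℕ)
open import Data.Fin.Properties using (toℕ-fromℕ<; toℕ-injective)
open import Data.Product using (Σ; Σ-syntax; _×_; _,_)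
open import Data.Sum using (_⊎_; inj₁; inj₂)
open import Function.Bundles using (_⤖_; _⇔_; Bijection)
open import Relation.Binary.PropositionalEquality using (_≡_; _≢_; refl; sym; trans; cong; subst)
open import Relation.Binary.Construct.Closure.ReflexiveTransitive using (Star)

-- Incidence structures  ⟨S, 𝓛, I⟩  (S ∩ 𝓛 = ∅ is automatic: separate types)

record IncStr : Set₁ where
  field
    Point : Set
    Line  : Set
    _I_   : Point → Line → Set

open IncStr public

record IsPLS (M : IncStr) : Set where
  private
    _∣_ = _I_ M
  field
    line-two-points : ∀ (l : Line M) → Σ[ a ∈ Point M ] Σ[ b ∈ Point M ] (a ≢ b × a ∣ l × b ∣ l)
    point-two-lines : ∀ (a : Point M) → Σ[ l ∈ Line M ] Σ[ m ∈ Line M ] (l ≢ m × a ∣ l × a ∣ m)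
    at-most-one-line : ∀ (a b : Point M) (l m : Line M) → a ≢ b →
                       a ∣ l → b ∣ l → a ∣ m → b ∣ m → l ≡ m

Collinear : (M : IncStr) → Point M → Point M → Set
Collinear M a b = Σ[ l ∈ Line M ] (_I_ M a l × _I_ M b l)

IsConnected : (M : IncStr) → Set
IsConnected M = ∀ (a b : Point M) → Star (Collinear M) a b

IsConnectedPLS : IncStr → Set
IsConnectedPLS M = IsPLS M × IsConnected M

record Correlation (M N : IncStr) : Set where
  field
    φ′  : Point M ⤖ Line N
    φ″  : Line M ⤖ Point N
    incidence : ∀ (a : Point M) (l : Line M) →
                _I_ M a l ⇔ _I_ N (Bijection.to φ″ l) (Bijection.to φ′ a)

open Correlation public

-- elements (points ⊎ lines) of a structure; a correlation acts on them
-- by swapping sides, and componentwise composition of correlations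
-- ((ψφ)' = ψ''φ', (ψφ)'' = ψ'φ'') is ordinary composition of these maps
Elt : IncStr → Set
Elt M = Point M ⊎ Line M

act : ∀ {M N} → Correlation M N → Elt M → Elt N
act φ (inj₁ a) = inj₂ (Bijection.to (φ′ φ) a)
act φ (inj₂ l) = inj₁ (Bijection.to (φ″ φ) l)

Odd : ℕ → Set
Odd k = Σ[ m ∈ ℕ ] k ≡ suc (2 * m)

zeroC : ∀ {k} {{_ : NonZero k}} → Fin k
zeroC {k} = 0 mod k

cnext : ∀ {k} {{_ : NonZero k}} → Fin k → Fin k
cnext {k} i = suc (toℕ i) mod k

iter : ∀ {k} {{_ : NonZero k}} → ℕ → Fin k → Fin k
iter zero    i = i
iter (suc n) i = cnext (iter n i)

toℕ-iter : ∀ {k} {{_ : NonZero k}} (n : ℕ) → toℕ (iter {k} n zeroC) ≡ n % k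
toℕ-iter {k} zero = toℕ-fromℕ< _
toℕ-iter {k} (suc n) = trans (toℕ-fromℕ< _) (trans (cong (λ x → suc x % k) (toℕ-iter n))
  (trans (%-distribˡ-+ 1 (n % k) k)
  (trans (cong (λ x → (1 % k + x) % k) (m%n%n≡m%n n k)) (sym (%-distribˡ-+ 1 n k)))))

iter-k : ∀ {k} {{_ : NonZero k}} → iter {k} k zeroC ≡ zeroC
iter-k {k} = toℕ-injective (trans (toℕ-iter k) (trans (n%n≡0 k) (trans (sym (Data.Nat.DivMod.m*n%n≡0 0 k)) (sym (toℕ-fromℕ< _)))))

module Chain {k : ℕ} {{_ : NonZero k}}
             (M : Fin k → IncStr)
             (φ : (i : Fin k) → Correlation (M i) (M (cnext i))) where

  chain : (n : ℕ) (i : Fin k) → Elt (M i) → Elt (M (iter n i))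
  chain zero    i x = x
  chain (suc n) i x = act (φ (iter n i)) (chain n i x)

  -- ϰ = φ_{k-1} ∘ … ∘ φ_1 ∘ φ_0, a map of M_0 to itself (index k ≡ 0 in C_k)
  ϰ : Elt (M zeroC) → Elt (M zeroC)
  ϰ x = subst (λ j → Elt (M j)) iter-k (chain k zeroC x)

  data GI : Σ (Fin k) (λ i → Point (M i)) → Σ (Fin k) (λ i → Line (M i)) → Set where
    same : ∀ {i a m} → _I_ (M i) a m → GI (i , a) (i , m)
    glue : ∀ {j m} → GI (cnext j , Bijection.to (φ″ (φ j)) m) (j , m)

  Glued : IncStr
  Glued = record { Point = Σ (Fin k) (λ i → Point (M i))
                 ; Line  = Σ (Fin k) (λ i → Line (M i))
                 ; _I_   = GI }

-- Correlative multiplying  M₀ ⊛_{ϰ₀} k ; ϰ₀ given through its action on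
-- elements, so "a = ϰ₀''(l)" reads  ϰ₀ (inj₂ l) ≡ inj₁ a

module Multiply (k : ℕ) {{_ : NonZero k}} (M₀ : IncStr) (κ : Elt M₀ → Elt M₀) where

  data MI : Fin k × Point M₀ → Fin k × Line M₀ → Set where
    same : ∀ {i a l} → _I_ M₀ a l → MI (i , a) (i , l)
    glue : ∀ {j a l} → κ (inj₂ l) ≡ inj₁ a → MI (cnext j , a) (j , l)

  Mult : IncStr
  Mult = record { Point = Fin k × Point M₀ ; Line = Fin k × Line M₀ ; _I_ = MI }

record _≅_ (M N : IncStr) : Set where
  field
    onPoints : Point M ⤖ Point N
    onLines  : Line M ⤖ Line N
    preserves : ∀ (a : Point M) (l : Line M) →
                _I_ M a l ⇔ _I_ N (Bijection.to onPoints a) (Bijection.to onLines l)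

-- Let ϰ = φ_{k-1} ⋯ φ_0, a correlation of M₀ because k is odd. For 0 ≤ i < k
-- the map ψ_i = ϰ^i ∘ (φ_{i-1} ⋯ φ_0)⁻¹ exchanges points and lines an even
-- number of times, so it is an isomorphism of M_i onto M₀, and
-- ψ_{i+1} ∘ φ_i = ϰ ∘ ψ_i. For i + 1 < k this holds by construction; at the
-- wrap-around i = k - 1 it reduces to ϰ^{k-1} = id, which holds because ϰ is
-- involutive and k - 1 is even. These identities say exactly that the ψ_i glue
-- to an isomorphism of the glued structure onto M₀ ⊛_ϰ k.

module Submission where

open import Defs
open import Data.Nat using (ℕ; zero; suc; _≤_; _<_; _*_; z<s; NonZero)
open import Data.Fin using (Fin; toℕ)
open import Data.Nat.Properties using (*-suc; ≤-refl; m≤n⇒m<n∨m≡n)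
open import Data.Nat.DivMod using (m<n⇒m%n≡m)
open import Data.Fin.Properties using (toℕ<n; toℕ-injective; _≟_)
open import Data.Bool using (Bool; true; false; not; _xor_)
open import Data.Bool.Properties using (xor-assoc; xor-same; not-involutive)
open import Data.Product using (Σ; _,_)
open import Data.Sum using (_⊎_; inj₁; inj₂)
open import Data.Sum.Properties using (inj₁-injective; inj₂-injective)
open import Data.Empty using (⊥)
open import Function using (_∘_)
open import Function.Bundles using (_⇔_; _↔_; Inverse; Bijection; Equivalence; mk⇔; mk↔ₛ′)
open import Function.Construct.Composition using (_⇔-∘_)
open import Function.Construct.Identity using (⇔-id)
open import Function.Construct.Symmetry using (⇔-sym)
open import Function.Properties.Inverse using (↔⇒⤖)
open import Function.Properties.Bijection using (⤖⇒↔)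
open import Axiom.UniquenessOfIdentityProofs using (module Decidable⇒UIP)
open import Relation.Binary.PropositionalEquality
  using (_≡_; refl; sym; trans; cong; subst; subst₂; module ≡-Reasoning)

isPoint : ∀ {A B : Set} → A ⊎ B → Bool
isPoint (inj₁ _) = true
isPoint (inj₂ _) = false

fromPoint : ∀ {A B : Set} (x : A ⊎ B) → isPoint x ≡ true → A
fromPoint (inj₁ a) _ = a

fromLine : ∀ {A B : Set} (x : A ⊎ B) → isPoint x ≡ false → B
fromLine (inj₂ l) _ = l

inj₁-fromPoint : ∀ {A B : Set} (x : A ⊎ B) p → inj₁ (fromPoint x p) ≡ x
inj₁-fromPoint (inj₁ a) _ = refl

inj₂-fromLine : ∀ {A B : Set} (x : A ⊎ B) p → inj₂ (fromLine x p) ≡ x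
inj₂-fromLine (inj₂ l) _ = refl

Adj : (M : IncStr) → Elt M → Elt M → Set
Adj M (inj₁ a) (inj₂ l) = _I_ M a l
Adj M (inj₂ l) (inj₁ a) = _I_ M a l
Adj M (inj₁ _) (inj₁ _) = ⊥
Adj M (inj₂ _) (inj₂ _) = ⊥

-- Isomorphisms of incidence graphs; collineations (swaps = false) and
-- correlations (swaps = true) are both of this form.

record EltIso (swaps : Bool) (M N : IncStr) : Set where
  field
    to        : Elt M → Elt N
    from      : Elt N → Elt M
    from∘to   : ∀ x → from (to x) ≡ x
    to∘from   : ∀ y → to (from y) ≡ y
    adjacency : ∀ x y → Adj M x y ⇔ Adj N (to x) (to y)
    kind      : ∀ x → isPoint (to x) ≡ swaps xor isPoint x

open EltIso public

idᴱ : ∀ {M} → EltIso false M M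
idᴱ = record
  { to = λ x → x ; from = λ x → x ; from∘to = λ _ → refl ; to∘from = λ _ → refl
  ; adjacency = λ _ _ → ⇔-id _ ; kind = λ _ → refl }

infixr 9 _∘ᴱ_

_∘ᴱ_ : ∀ {b c M N P} → EltIso c N P → EltIso b M N → EltIso (c xor b) M P
_∘ᴱ_ {b} {c} g f = record
  { to        = λ x → to g (to f x)
  ; from      = λ z → from f (from g z)
  ; from∘to   = λ x → trans (cong (from f) (from∘to g (to f x))) (from∘to f x)
  ; to∘from   = λ z → trans (cong (to g) (to∘from f (from g z))) (to∘from g z)
  ; adjacency = λ x y → adjacency g (to f x) (to f y) ⇔-∘ adjacency f x y
  ; kind      = λ x → trans (kind g (to f x))
                  (trans (cong (c xor_) (kind f x)) (sym (xor-assoc c b (isPoint x))))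
  }

xor-cancelˡ : ∀ b c → b xor (b xor c) ≡ c
xor-cancelˡ b c = trans (sym (xor-assoc b b c)) (cong (_xor c) (xor-same b))

_⁻¹ : ∀ {b M N} → EltIso b M N → EltIso b N M
_⁻¹ {b} {M} {N} f = record
  { to        = from f
  ; from      = to f
  ; from∘to   = to∘from f
  ; to∘from   = from∘to f
  ; adjacency = λ x y → subst₂ (λ x′ y′ → Adj N x′ y′ ⇔ Adj M (from f x) (from f y))
                  (to∘from f x) (to∘from f y) (⇔-sym (adjacency f (from f x) (from f y)))
  ; kind      = λ y → trans (sym (xor-cancelˡ b _))
                  (cong (b xor_) (trans (sym (kind f (from f y))) (cong isPoint (to∘from f y))))
  }

castSwaps : ∀ {b c M N} → b ≡ c → EltIso b M N → EltIso c M N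
castSwaps b≡c f = record
  { to = to f ; from = from f ; from∘to = from∘to f ; to∘from = to∘from f
  ; adjacency = adjacency f ; kind = λ x → trans (kind f x) (cong (_xor isPoint x) b≡c) }

castᴱ : ∀ {X : Set} (A : X → IncStr) {x y : X} → x ≡ y → EltIso false (A x) (A y)
castᴱ A refl = idᴱ

to-castᴱ : ∀ {X : Set} (A : X → IncStr) {x y : X} (p : x ≡ y) (e : Elt (A x)) →
           to (castᴱ A p) e ≡ subst (λ z → Elt (A z)) p e
to-castᴱ A refl e = refl

correlationᴱ : ∀ {M N} → Correlation M N → EltIso true M N
correlationᴱ {M} {N} φ = record
  { to = act φ ; from = act⁻¹ ; from∘to = act⁻¹-act ; to∘from = act-act⁻¹
  ; adjacency = adjacency-act ; kind = kind-act }
  where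
  module P = Inverse (⤖⇒↔ (φ′ φ))
  module L = Inverse (⤖⇒↔ (φ″ φ))
  act⁻¹ : Elt N → Elt M
  act⁻¹ (inj₁ a) = inj₂ (L.from a)
  act⁻¹ (inj₂ l) = inj₁ (P.from l)
  act⁻¹-act : ∀ x → act⁻¹ (act φ x) ≡ x
  act⁻¹-act (inj₁ a) = cong inj₁ (P.strictlyInverseʳ a)
  act⁻¹-act (inj₂ l) = cong inj₂ (L.strictlyInverseʳ l)
  act-act⁻¹ : ∀ y → act φ (act⁻¹ y) ≡ y
  act-act⁻¹ (inj₁ a) = cong inj₁ (L.strictlyInverseˡ a)
  act-act⁻¹ (inj₂ l) = cong inj₂ (P.strictlyInverseˡ l)
  adjacency-act : ∀ x y → Adj M x y ⇔ Adj N (act φ x) (act φ y)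
  adjacency-act (inj₁ a) (inj₂ l) = incidence φ a l
  adjacency-act (inj₂ l) (inj₁ a) = incidence φ a l
  adjacency-act (inj₁ _) (inj₁ _) = mk⇔ (λ ()) (λ ())
  adjacency-act (inj₂ _) (inj₂ _) = mk⇔ (λ ()) (λ ())
  kind-act : ∀ x → isPoint (act φ x) ≡ true xor isPoint x
  kind-act (inj₁ _) = refl
  kind-act (inj₂ _) = refl

parity : ℕ → Bool
parity zero    = false
parity (suc n) = not (parity n)

parity-double : ∀ m → parity (2 * m) ≡ false
parity-double zero    = refl
parity-double (suc m) = trans (cong parity (*-suc 2 m))
  (trans (not-involutive (parity (2 * m))) (parity-double m))

infixr 10 _^ᴱ_

_^ᴱ_ : ∀ {M} → EltIso true M M → (n : ℕ) → EltIso (parity n) M M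
f ^ᴱ zero  = idᴱ
f ^ᴱ suc n = f ∘ᴱ f ^ᴱ n

^ᴱ-double : ∀ {M} (f : EltIso true M M) → (∀ x → to f (to f x) ≡ x) →
            ∀ m x → to (f ^ᴱ (2 * m)) x ≡ x
^ᴱ-double f invol zero    x = refl
^ᴱ-double f invol (suc m) x = subst (λ n → to (f ^ᴱ n) x ≡ x) (sym (*-suc 2 m))
  (trans (invol (to (f ^ᴱ (2 * m)) x)) (^ᴱ-double f invol m x))

onPointsᴱ : ∀ {M N} → EltIso false M N → Point M → Point N
onPointsᴱ f a = fromPoint (to f (inj₁ a)) (kind f (inj₁ a))

onLinesᴱ : ∀ {M N} → EltIso false M N → Line M → Line N
onLinesᴱ f l = fromLine (to f (inj₂ l)) (kind f (inj₂ l))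

inj₁-onPointsᴱ : ∀ {M N} (f : EltIso false M N) a → inj₁ (onPointsᴱ f a) ≡ to f (inj₁ a)
inj₁-onPointsᴱ f a = inj₁-fromPoint _ _

inj₂-onLinesᴱ : ∀ {M N} (f : EltIso false M N) l → inj₂ (onLinesᴱ f l) ≡ to f (inj₂ l)
inj₂-onLinesᴱ f l = inj₂-fromLine _ _

onPointsᴱ-inverse : ∀ {M N} (g : EltIso false N M) (f : EltIso false M N) →
                    (∀ x → to g (to f x) ≡ x) → ∀ a → onPointsᴱ g (onPointsᴱ f a) ≡ a
onPointsᴱ-inverse g f gf a = inj₁-injective
  (trans (inj₁-onPointsᴱ g _) (trans (cong (to g) (inj₁-onPointsᴱ f a)) (gf (inj₁ a))))

onLinesᴱ-inverse : ∀ {M N} (g : EltIso false N M) (f : EltIso false M N) →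
                   (∀ x → to g (to f x) ≡ x) → ∀ l → onLinesᴱ g (onLinesᴱ f l) ≡ l
onLinesᴱ-inverse g f gf l = inj₂-injective
  (trans (inj₂-onLinesᴱ g _) (trans (cong (to g) (inj₂-onLinesᴱ f l)) (gf (inj₂ l))))

pointsᴱ : ∀ {M N} → EltIso false M N → Point M ↔ Point N
pointsᴱ f = mk↔ₛ′ (onPointsᴱ f) (onPointsᴱ (f ⁻¹))
  (onPointsᴱ-inverse f (f ⁻¹) (to∘from f)) (onPointsᴱ-inverse (f ⁻¹) f (from∘to f))

linesᴱ : ∀ {M N} → EltIso false M N → Line M ↔ Line N
linesᴱ f = mk↔ₛ′ (onLinesᴱ f) (onLinesᴱ (f ⁻¹))
  (onLinesᴱ-inverse f (f ⁻¹) (to∘from f)) (onLinesᴱ-inverse (f ⁻¹) f (from∘to f))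

incidenceᴱ : ∀ {M N} (f : EltIso false M N) a l →
             _I_ M a l ⇔ _I_ N (onPointsᴱ f a) (onLinesᴱ f l)
incidenceᴱ {M} {N} f a l = subst₂ (λ x y → _I_ M a l ⇔ Adj N x y)
  (sym (inj₁-onPointsᴱ f a)) (sym (inj₂-onLinesᴱ f l)) (adjacency f (inj₁ a) (inj₂ l))

Σ-↔ : ∀ {X : Set} {A B : X → Set} → (∀ i → A i ↔ B i) → Σ X A ↔ Σ X B
Σ-↔ f = mk↔ₛ′ (λ (i , a) → i , Inverse.to (f i) a) (λ (i , b) → i , Inverse.from (f i) b)
  (λ (i , b) → cong (i ,_) (Inverse.strictlyInverseˡ (f i) b))
  (λ (i , a) → cong (i ,_) (Inverse.strictlyInverseʳ (f i) a))

module _ {k : ℕ} {{_ : NonZero k}} (M : Fin k → IncStr)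
         (φ : (i : Fin k) → Correlation (M i) (M (cnext i)))
         {M₀ : IncStr} (κ : Elt M₀ → Elt M₀) where
  open Chain M φ using (Glued; GI)
  open Multiply k M₀ κ using (Mult; MI)

  glued≅multiplied : (ψ : ∀ i → EltIso false (M i) M₀) →
                     (∀ j x → to (ψ (cnext j)) (act (φ j) x) ≡ κ (to (ψ j) x)) →
                     Glued ≅ Mult
  glued≅multiplied ψ intertwines = record
    { onPoints  = ↔⇒⤖ (Σ-↔ (λ i → pointsᴱ (ψ i)))
    ; onLines   = ↔⇒⤖ (Σ-↔ (λ i → linesᴱ (ψ i)))
    ; preserves = λ (i , a) (j , m) → mk⇔ forward backward
    }
    where
    P : ∀ i → Point (M i) → Point M₀
    P i = onPointsᴱ (ψ i)
    L : ∀ i → Line (M i) → Line M₀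
    L i = onLinesᴱ (ψ i)
    φ″ⱼ : ∀ j → Line (M j) → Point (M (cnext j))
    φ″ⱼ j = Bijection.to (φ″ (φ j))

    glue-image : ∀ j m → κ (inj₂ (L j m)) ≡ inj₁ (P (cnext j) (φ″ⱼ j m))
    glue-image j m = begin
      κ (inj₂ (L j m))                      ≡⟨ cong κ (inj₂-onLinesᴱ (ψ j) m) ⟩
      κ (to (ψ j) (inj₂ m))                 ≡⟨ intertwines j (inj₂ m) ⟨
      to (ψ (cnext j)) (inj₁ (φ″ⱼ j m))      ≡⟨ inj₁-onPointsᴱ (ψ (cnext j)) _ ⟨
      inj₁ (P (cnext j) (φ″ⱼ j m))           ∎
      where open ≡-Reasoning

    forward : ∀ {i a j m} → GI (i , a) (j , m) → MI (i , P i a) (j , L j m)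
    forward {i} {a} {_} {m} (GI.same r) = MI.same (Equivalence.to (incidenceᴱ (ψ i) a m) r)
    forward {_} {_} {j} {m} GI.glue     = MI.glue (glue-image j m)

    backward : ∀ {i a j m} → MI (i , P i a) (j , L j m) → GI (i , a) (j , m)
    backward {i} {a} {_} {m} (MI.same r) = GI.same (Equivalence.from (incidenceᴱ (ψ i) a m) r)
    backward {_} {a} {j} {m} (MI.glue eq) =
      subst (λ b → GI (cnext j , b) (j , m)) (sym a≡φ″m) GI.glue
      where
      a≡φ″m : a ≡ φ″ⱼ j m
      a≡φ″m = Bijection.injective (↔⇒⤖ (pointsᴱ (ψ (cnext j))))
                (inj₁-injective (trans (sym eq) (glue-image j m)))

module _ {k : ℕ} {{_ : NonZero k}} where

  toℕ-iter-< : ∀ n → n < k → toℕ (iter n (zeroC {k})) ≡ n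
  toℕ-iter-< n n<k = trans (toℕ-iter n) (m<n⇒m%n≡m n<k)

  iter-toℕ : ∀ i → i ≡ iter (toℕ i) (zeroC {k})
  iter-toℕ i = sym (toℕ-injective (toℕ-iter-< (toℕ i) (toℕ<n i)))

module _ {k : ℕ} {{_ : NonZero k}} (M : Fin k → IncStr)
         (φ : (i : Fin k) → Correlation (M i) (M (cnext i))) where
  open Chain M φ using (chain)

  chainᴱ : (n : ℕ) (i : Fin k) → EltIso (parity n) (M i) (M (iter n i))
  chainᴱ zero    i = idᴱ
  chainᴱ (suc n) i = correlationᴱ (φ (iter n i)) ∘ᴱ chainᴱ n i

  to-chainᴱ : ∀ n i x → to (chainᴱ n i) x ≡ chain n i x
  to-chainᴱ zero    i x = refl
  to-chainᴱ (suc n) i x = cong (act (φ (iter n i))) (to-chainᴱ n i x)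

module Untwisting (m : ℕ) (M : Fin (suc (2 * m)) → IncStr)
                  (φ : (i : Fin (suc (2 * m))) → Correlation (M i) (M (cnext i)))
                  (ϰ-involutive : ∀ x → Chain.ϰ M φ (Chain.ϰ M φ x) ≡ x) where
  open Chain M φ using (ϰ)

  private
    k : ℕ
    k = suc (2 * m)

    z : Fin k
    z = zeroC

  open Decidable⇒UIP (_≟_ {k}) using (≡-irrelevant)

  ϰᴱ : EltIso true (M z) (M z)
  ϰᴱ = castSwaps (cong not (parity-double m)) (castᴱ M (iter-k {k}) ∘ᴱ chainᴱ M φ k z)

  to-ϰᴱ : ∀ x → to ϰᴱ x ≡ ϰ x
  to-ϰᴱ x = trans (to-castᴱ M (iter-k {k}) _)
    (cong (subst (λ j → Elt (M j)) (iter-k {k})) (to-chainᴱ M φ k z x))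

  ϰᴱ-involutive : ∀ x → to ϰᴱ (to ϰᴱ x) ≡ x
  ϰᴱ-involutive x = trans (to-ϰᴱ _) (trans (cong ϰ (to-ϰᴱ x)) (ϰ-involutive x))

  ψⁿ : (n : ℕ) → EltIso false (M (iter n z)) (M z)
  ψⁿ n = castSwaps (xor-same (parity n)) (ϰᴱ ^ᴱ n ∘ᴱ chainᴱ M φ n z ⁻¹)

  ψ : (i : Fin k) → EltIso false (M i) (M z)
  ψ i = ψⁿ (toℕ i) ∘ᴱ castᴱ M (iter-toℕ i)

  ψ-via-ψⁿ : ∀ {i} n (p : i ≡ iter n z) → n < k → ∀ y →
             to (ψ i) y ≡ to (ψⁿ n) (to (castᴱ M p) y)
  ψ-via-ψⁿ n refl n<k y = ψⁿ-cast (toℕ-iter-< n n<k) (iter-toℕ (iter n z))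
    where
    ψⁿ-cast : ∀ {t} → t ≡ n → (q : iter n z ≡ iter t z) →
              to (ψⁿ t) (to (castᴱ M q) y) ≡ to (ψⁿ n) y
    ψⁿ-cast refl q =
      subst (λ (q : iter n z ≡ iter n z) → to (ψⁿ n) (to (castᴱ M q) y) ≡ to (ψⁿ n) y)
            (≡-irrelevant refl q) refl

  ψ-intertwines-wrap : ∀ x →
    to (ψ (iter k z)) (act (φ (iter (2 * m) z)) x) ≡ ϰ (to (ψ (iter (2 * m) z)) x)
  ψ-intertwines-wrap x = begin
    to (ψ (iter k z)) (act φ₂ₘ x)                  ≡⟨ ψ-via-ψⁿ 0 iter-k z<s _ ⟩
    to (castᴱ M iter-k) (act φ₂ₘ x)                ≡⟨ to-castᴱ M iter-k _ ⟩
    subst P iter-k (act φ₂ₘ x)                     ≡⟨ cong (subst P iter-k ∘ act φ₂ₘ) (to∘from c₂ₘ x) ⟨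
    subst P iter-k (act φ₂ₘ (to c₂ₘ (from c₂ₘ x)))
      ≡⟨ cong (subst P iter-k ∘ act φ₂ₘ) (to-chainᴱ M φ (2 * m) z _) ⟩
    ϰ (from c₂ₘ x)                                 ≡⟨ cong ϰ (^ᴱ-double ϰᴱ ϰᴱ-involutive m _) ⟨
    ϰ (to (ψⁿ (2 * m)) x)                          ≡⟨ cong ϰ (ψ-via-ψⁿ (2 * m) refl ≤-refl x) ⟨
    ϰ (to (ψ (iter (2 * m) z)) x)                  ∎
    where
    open ≡-Reasoning
    P : Fin k → Set
    P j = Elt (M j)
    φ₂ₘ : Correlation (M (iter (2 * m) z)) (M (iter k z))
    φ₂ₘ = φ (iter (2 * m) z)
    c₂ₘ : EltIso (parity (2 * m)) (M z) (M (iter (2 * m) z))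
    c₂ₘ = chainᴱ M φ (2 * m) z

  ψ-intertwines-iter : ∀ n → n < k → ∀ x →
    to (ψ (iter (suc n) z)) (act (φ (iter n z)) x) ≡ ϰ (to (ψ (iter n z)) x)
  ψ-intertwines-iter n n<k x with m≤n⇒m<n∨m≡n n<k
  ... | inj₂ refl  = ψ-intertwines-wrap x
  ... | inj₁ 1+n<k = begin
    to (ψ (iter (suc n) z)) (act φₙ x)     ≡⟨ ψ-via-ψⁿ (suc n) refl 1+n<k _ ⟩
    to ϰᴱ (to (ψⁿ n) (from cφₙ (act φₙ x))) ≡⟨ cong (to ϰᴱ ∘ to (ψⁿ n)) (from∘to cφₙ x) ⟩
    to ϰᴱ (to (ψⁿ n) x)                     ≡⟨ to-ϰᴱ _ ⟩
    ϰ (to (ψⁿ n) x)                         ≡⟨ cong ϰ (ψ-via-ψⁿ n refl n<k x) ⟨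
    ϰ (to (ψ (iter n z)) x)                 ∎
    where
    open ≡-Reasoning
    φₙ : Correlation (M (iter n z)) (M (iter (suc n) z))
    φₙ = φ (iter n z)
    cφₙ : EltIso true (M (iter n z)) (M (iter (suc n) z))
    cφₙ = correlationᴱ φₙ

  ψ-intertwines : ∀ j x → to (ψ (cnext j)) (act (φ j) x) ≡ ϰ (to (ψ j) x)
  ψ-intertwines j = subst (λ i → ∀ x → to (ψ (cnext i)) (act (φ i) x) ≡ ϰ (to (ψ i) x))
    (sym (iter-toℕ j)) (ψ-intertwines-iter (toℕ j) (toℕ<n j))

proposition4p5 : (k : ℕ) {{_ : NonZero k}} → 3 ≤ k → Odd k →
    (M : Fin k → IncStr) → (∀ i → IsConnectedPLS (M i)) →
    (φ : (i : Fin k) → Correlation (M i) (M (cnext i))) →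
    (∀ x → Chain.ϰ M φ (Chain.ϰ M φ x) ≡ x) →
    Chain.Glued M φ ≅ Multiply.Mult k (M zeroC) (Chain.ϰ M φ)
proposition4p5 .(suc (2 * m)) _ (m , refl) M _ φ ϰ-involutive =
  glued≅multiplied M φ (Chain.ϰ M φ) ψ ψ-intertwines
  where open Untwisting m M φ ϰ-involutive
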